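{- For every $n\ge1$ and every $f\in B_n$, the size $|\mathcal{P}(f)|$ of a minimal $pPol$ cover for $f$ is at most the circuit complexity of $f$ (the minimum number of non-input gates in a circuit with fan-in two $\land$, $\lor$ gates and $\neg$ gates computing $f$).
   Context: $B_k$ is the set of Boolean functions $\{0,1\}^k\to\{0,1\}$ and $P_k$ the set of partial functions from $\{0,1\}^k$ to $\{0,1\}$ (possibly undefined on some inputs). Enumerate $\{0,1\}^n$ lexicographically as $a^1,\dots,a^{2^n}$. The truth table $f^{\bullet}$ is the $2^n\times(n+1)$ matrix with rows $(a^j,f(a^j))$. Vectors in $\{0,1\}^{2^n}$ are called columns; the columns of $f^{\bullet}$ are the input columns $x_1,\dots,x_n$ ($x_i[j]=a^j_i$) and the result column $r$ ($r[j]=f(a^j)$). For $w\in P_{2^n}$ and a column $v$, $w(v)$ denotes $w(v[1],\dots,v[2^n])$, which may be undefined. $\overline{pPol}(f^{\bullet})$ is the set of $w\in P_{2^n}$ such that $w(x_1),\dots,w(x_n),w(r)$ are all defined and $(w(x_1),\dots,w(x_n),w(r))$ is not a row of $f^{\bullet}$ (i.e. $w(r)\ne f(w(x_1),\dots,w(x_n))$). Gates: an $\land$-gate is a triple $(u,v,z)$ of columns with $z=u\land v$ componentwise, an $\lor$-gate a triple with $z=u\lor v$, a $\neg$-gate a pair $(u,z)$ with $z=\neg u$; $u,v$ are its input columns and $z$ its output column, and $\circ$ its operation. A gate covers $w\in P_{2^n}$ if $w$ is defined on all its input columns and either $w$ is undefined on its output column or $w(z)\neq w(u)\circ w(v)$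 (resp. $w(z)\neq\neg w(u)$). A $pPol$ cover for $f$ is a collection $\mathcal{P}$ of such gates such that every $w\in\overline{pPol}(f^{\bullet})$ is covered by some gate in $\mathcal{P}$, and moreover: (1) no two gates of $\mathcal{P}$ have the same output column, (2) $r$ is not an input column of any gate in $\mathcal{P}$, and (3) none of $x_1,\dots,x_n$ is the output column of a gate in $\mathcal{P}$. $\mathcal{P}(f)$ denotes a $pPol$ cover for $f$ with the minimum number of gates, and $|\mathcal{P}(f)|$ its number of gates. -}

module Defs where

open import Data.Nat using (ℕ; zero; suc; _+_; _^_; _≤_)
open import Data.Bool using (Bool; true; false; _∧_; _∨_; not)
open import Data.Fin using (Fin)
open import Data.Vec using (Vec; []; _∷_; _++_; map; lookup; zipWith)
open import Data.Maybe using (Maybe; just; nothing)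
open import Data.List using (List; length)
import Data.List as L
open import Data.List.Membership.Propositional using (_∈_)
open import Data.List.Relation.Unary.Unique.Propositional using (Unique)
open import Data.Sum using (_⊎_)
open import Data.Product using (Σ; _×_; _,_)
open import Relation.Binary.PropositionalEquality using (_≡_; _≢_)
open import Relation.Nullary using (¬_)

-- Inputs {0,1}^n are Vec Bool n (false = 0, true = 1); B_n = Vec Bool n → Bool.

-- Lexicographic enumeration a^1, …, a^{2^n} of {0,1}^n (a^1 = 0…0).
-- Length 2 ^ suc n reduces to 2^n + (2^n + 0).
allInputs : (n : ℕ) → Vec (Vec Bool n) (2 ^ n)
allInputs zero    = [] ∷ []
allInputs (suc n) =
  map (false ∷_) (allInputs n) ++ (map (true ∷_) (allInputs n) ++ [])

Col : ℕ → Set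
Col n = Vec Bool (2 ^ n)

xCol : {n : ℕ} → Fin n → Col n
xCol {n} i = map (λ a → lookup a i) (allInputs n)

rCol : {n : ℕ} → (Vec Bool n → Bool) → Col n
rCol {n} f = map f (allInputs n)

PFun : ℕ → Set
PFun n = Col n → Maybe Bool

InPPolBar : {n : ℕ} → (Vec Bool n → Bool) → PFun n → Set
InPPolBar {n} f w =
  Σ (Vec Bool n) λ bs → Σ Bool λ c →
    ((i : Fin n) → w (xCol i) ≡ just (lookup bs i)) ×
    (w (rCol f) ≡ just c) × (c ≢ f bs)

data Gate (n : ℕ) : Set where
  andG : Col n → Col n → Gate n
  orG  : Col n → Col n → Gate n
  notG : Col n → Gate n

outCol : {n : ℕ} → Gate n → Col n
outCol (andG u v) = zipWith _∧_ u v
outCol (orG u v)  = zipWith _∨_ u v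
outCol (notG u)   = map not u

IsInputOf : {n : ℕ} → Col n → Gate n → Set
IsInputOf c (andG u v) = (c ≡ u) ⊎ (c ≡ v)
IsInputOf c (orG u v)  = (c ≡ u) ⊎ (c ≡ v)
IsInputOf c (notG u)   = c ≡ u

Covers : {n : ℕ} → Gate n → PFun n → Set
Covers (andG u v) w = Σ Bool λ a → Σ Bool λ b →
  (w u ≡ just a) × (w v ≡ just b) × (w (zipWith _∧_ u v) ≢ just (a ∧ b))
Covers (orG u v) w = Σ Bool λ a → Σ Bool λ b →
  (w u ≡ just a) × (w v ≡ just b) × (w (zipWith _∨_ u v) ≢ just (a ∨ b))
Covers (notG u) w = Σ Bool λ a →
  (w u ≡ just a) × (w (map not u) ≢ just (not a))

record IsPPolCover {n : ℕ} (f : Vec Bool n → Bool) (P : List (Gate n)) : Set where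
  field
    covering      : (w : PFun n) → InPPolBar f w →
                    Σ (Gate n) λ g → (g ∈ P) × Covers g w
    distinctOut   : Unique (L.map outCol P)                       -- (1)
    rNotInput     : (g : Gate n) → g ∈ P → ¬ IsInputOf (rCol f) g  -- (2)
    xNotOutput    : (g : Gate n) → g ∈ P → (i : Fin n) →
                    outCol g ≢ xCol i                              -- (3)

-- Boolean circuits with fan-in two ∧, ∨ gates and ¬ gates.
-- Nodes of a circuit with s gates on n inputs are Fin (s + n):
-- index 0 is the most recent gate, …, indices s … s+n-1 are the inputs.

data CGate (m : ℕ) : Set where
  cand : Fin m → Fin m → CGate m
  cor  : Fin m → Fin m → CGate m
  cnot : Fin m → CGate m

data Gates (n : ℕ) : ℕ → Set where
  []  : Gates n 0
  _▷_ : {s : ℕ} → Gates n s → CGate (s + n) → Gates n (suc s)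

evalCGate : {m : ℕ} → CGate m → Vec Bool m → Bool
evalCGate (cand i j) v = lookup v i ∧ lookup v j
evalCGate (cor i j)  v = lookup v i ∨ lookup v j
evalCGate (cnot i)   v = not (lookup v i)

evalNodes : {n s : ℕ} → Gates n s → Vec Bool n → Vec Bool (s + n)
evalNodes []       x = x
evalNodes (gs ▷ g) x = evalCGate g (evalNodes gs x) ∷ evalNodes gs x

Computes : {n s : ℕ} → Gates n s → Fin (s + n) → (Vec Bool n → Bool) → Set
Computes gs o f = (x : Vec Bool _) → lookup (evalNodes gs x) o ≡ f x

module Submission where

-- Replace every gate of a circuit for f by the gate acting on the columns of its
-- input nodes, and keep only gates whose output column is new, stopping once the
-- result column r has appeared.  The surviving gates satisfy (1)–(3) and can be
-- listed so that every input of a gate is an x column or the output of an earlier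
-- gate.  Given w in pPol-bar(f), pick the row k with w(x_i) = a^k_i for all i.
-- Walking along the list, either some gate covers w, or w reads off row k on every
-- column produced so far; the latter would give w(r) = r[k] = f(w(x_1),…,w(x_n)).

open import Defs
open import Data.Nat using (ℕ; suc; _+_; _≤_; _^_; z≤n; s≤s)
open import Data.Nat.Properties using (m≤n⇒m≤1+n)
open import Data.Bool using (Bool; false; true; _∧_; _∨_; not)
open import Data.Bool.Properties using () renaming (_≟_ to _≟ᵇ_)
open import Data.Fin using (Fin; zero; suc; _↑ˡ_; _↑ʳ_)
open import Data.Vec using (Vec; []; _∷_; lookup; tabulate)
import Data.Vec as Vec
open import Data.Vec.Properties
  using (≡-dec; lookup-map; lookup-zipWith; lookup-++ˡ; lookup-++ʳ;
         lookup∘tabulate; tabulate∘lookup; tabulate-cong)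
open import Data.Maybe using (just)
import Data.Maybe.Properties as Maybe
open import Data.List using (List; []; _∷_; length)
import Data.List as List
open import Data.List.Relation.Unary.Any using (here; there)
open import Data.List.Relation.Unary.All using (All; []; _∷_)
import Data.List.Relation.Unary.All as All
import Data.List.Relation.Unary.All.Properties as All
open import Data.List.Relation.Unary.AllPairs using ([]; _∷_)
open import Data.List.Membership.Propositional using (_∈_; _∉_)
open import Data.List.Membership.Propositional.Properties
  using (∈-++⁺ˡ; ∈-++⁺ʳ; ∈-tabulate⁺)
import Data.List.Membership.DecPropositional as DecMembership
open import Data.List.Relation.Unary.Unique.Propositional using (Unique)
open import Data.Sum using (_⊎_; inj₁; inj₂; [_,_]′)
open import Data.Product using (Σ; ∃; _×_; _,_)
open import Data.Unit using (⊤; tt)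
open import Function using (id; _∘_)
open import Relation.Nullary using (¬_; yes; no; contradiction)
open import Relation.Binary.PropositionalEquality

allInputs-complete : ∀ {m} (bs : Vec Bool m) → ∃ λ k → lookup (allInputs m) k ≡ bs
allInputs-complete [] = zero , refl
allInputs-complete {suc m} (false ∷ bs) with allInputs-complete bs
... | k , k↦bs = k ↑ˡ (2 ^ m + 0) , (begin
  lookup (allInputs (suc m)) (k ↑ˡ _)
    ≡⟨ lookup-++ˡ (Vec.map (false ∷_) (allInputs m)) _ k ⟩
  lookup (Vec.map (false ∷_) (allInputs m)) k
    ≡⟨ lookup-map k (false ∷_) (allInputs m) ⟩
  false ∷ lookup (allInputs m) k
    ≡⟨ cong (false ∷_) k↦bs ⟩
  false ∷ bs ∎)
  where open ≡-Reasoning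
allInputs-complete {suc m} (true ∷ bs) with allInputs-complete bs
... | k , k↦bs = (2 ^ m) ↑ʳ (k ↑ˡ 0) , (begin
  lookup (allInputs (suc m)) ((2 ^ m) ↑ʳ (k ↑ˡ 0))
    ≡⟨ lookup-++ʳ (Vec.map (false ∷_) (allInputs m)) _ (k ↑ˡ 0) ⟩
  lookup (Vec.map (true ∷_) (allInputs m) Vec.++ []) (k ↑ˡ 0)
    ≡⟨ lookup-++ˡ (Vec.map (true ∷_) (allInputs m)) [] k ⟩
  lookup (Vec.map (true ∷_) (allInputs m)) k
    ≡⟨ lookup-map k (true ∷_) (allInputs m) ⟩
  true ∷ lookup (allInputs m) k
    ≡⟨ cong (true ∷_) k↦bs ⟩
  true ∷ bs ∎)
  where open ≡-Reasoning

module _ {n : ℕ} where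

  open DecMembership {A = Col n} (≡-dec _≟ᵇ_) using (_∈?_)

  columnGate : ∀ {m} → CGate m → Vec (Col n) m → Gate n
  columnGate (cand i j) cs = andG (lookup cs i) (lookup cs j)
  columnGate (cor i j)  cs = orG (lookup cs i) (lookup cs j)
  columnGate (cnot i)   cs = notG (lookup cs i)

  nodeCols : ∀ {s} → Gates n s → Vec (Col n) (s + n)
  nodeCols []       = tabulate xCol
  nodeCols (gs ▷ g) = outCol (columnGate g (nodeCols gs)) ∷ nodeCols gs

  lookup-xCol : (i : Fin n) (k : Fin (2 ^ n)) →
    lookup (xCol i) k ≡ lookup (lookup (allInputs n) k) i
  lookup-xCol i k = lookup-map k (λ a → lookup a i) (allInputs n)

  lookup-rCol : (f : Vec Bool n → Bool) (k : Fin (2 ^ n)) →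
    lookup (rCol f) k ≡ f (lookup (allInputs n) k)
  lookup-rCol f k = lookup-map k f (allInputs n)

  lookup-nodeCols : ∀ {s} (gs : Gates n s) (o : Fin (s + n)) (k : Fin (2 ^ n)) →
    lookup (lookup (nodeCols gs) o) k ≡ lookup (evalNodes gs (lookup (allInputs n) k)) o
  lookup-nodeCols [] o k rewrite lookup∘tabulate xCol o = lookup-xCol o k
  lookup-nodeCols (gs ▷ cand i j) zero k =
    trans (lookup-zipWith _∧_ k (lookup (nodeCols gs) i) (lookup (nodeCols gs) j))
          (cong₂ _∧_ (lookup-nodeCols gs i k) (lookup-nodeCols gs j k))
  lookup-nodeCols (gs ▷ cor i j) zero k =
    trans (lookup-zipWith _∨_ k (lookup (nodeCols gs) i) (lookup (nodeCols gs) j))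
          (cong₂ _∨_ (lookup-nodeCols gs i k) (lookup-nodeCols gs j k))
  lookup-nodeCols (gs ▷ cnot i) zero k =
    trans (lookup-map k not (lookup (nodeCols gs) i)) (cong not (lookup-nodeCols gs i k))
  lookup-nodeCols (gs ▷ g) (suc o) k = lookup-nodeCols gs o k

  nodeCol≡rCol : ∀ {s} (gs : Gates n s) (o : Fin (s + n)) {f : Vec Bool n → Bool} →
    Computes gs o f → lookup (nodeCols gs) o ≡ rCol f
  nodeCol≡rCol gs o {f} computes = begin
    lookup (nodeCols gs) o                     ≡⟨ sym (tabulate∘lookup _) ⟩
    tabulate (lookup (lookup (nodeCols gs) o)) ≡⟨ tabulate-cong agree ⟩
    tabulate (lookup (rCol f))                 ≡⟨ tabulate∘lookup _ ⟩
    rCol f                                     ∎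
    where
      open ≡-Reasoning
      agree : ∀ k → lookup (lookup (nodeCols gs) o) k ≡ lookup (rCol f) k
      agree k = trans (lookup-nodeCols gs o k) (trans (computes _) (sym (lookup-rCol f k)))

  AllInputs : (Col n → Set) → Gate n → Set
  AllInputs Q g = ∀ {c} → IsInputOf c g → Q c

  columnGate-inputs : ∀ {m} (g : CGate m) (cs : Vec (Col n) m) {Q : Col n → Set} →
    (∀ o → Q (lookup cs o)) → AllInputs Q (columnGate g cs)
  columnGate-inputs (cand i j) cs Qcs (inj₁ refl) = Qcs i
  columnGate-inputs (cand i j) cs Qcs (inj₂ refl) = Qcs j
  columnGate-inputs (cor i j)  cs Qcs (inj₁ refl) = Qcs i
  columnGate-inputs (cor i j)  cs Qcs (inj₂ refl) = Qcs j
  columnGate-inputs (cnot i)   cs Qcs refl        = Qcs i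

  availableCols : List (Gate n) → List (Col n)
  availableCols P = List.map outCol P List.++ List.tabulate (xCol {n})

  xCol∈availableCols : (P : List (Gate n)) (i : Fin n) → xCol i ∈ availableCols P
  xCol∈availableCols P i = ∈-++⁺ʳ (List.map outCol P) (∈-tabulate⁺ i)

  WellFormed : List (Gate n) → Set
  WellFormed []      = ⊤
  WellFormed (g ∷ P) = AllInputs (_∈ availableCols P) g × WellFormed P

  record Admissible (r : Col n) (P : List (Gate n)) : Set where
    field
      wellFormed  : WellFormed P
      distinctOut : Unique (List.map outCol P)
      xNotOutput  : All (λ g → (i : Fin n) → outCol g ≢ xCol i) P
      rNotInput   : All (λ g → ¬ IsInputOf r g) P

  open Admissible

  Admissible-[] : ∀ {r} → Admissible r []
  Admissible-[] = record
    { wellFormed = tt ; distinctOut = [] ; xNotOutput = [] ; rNotInput = [] }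

  Admissible-∷ : ∀ {r P g} → Admissible r P → AllInputs (_∈ availableCols P) g →
    r ∉ availableCols P → outCol g ∉ availableCols P → Admissible r (g ∷ P)
  Admissible-∷ {P = P} adm inputs r∉ new = record
    { wellFormed  = inputs , wellFormed adm
    ; distinctOut = All.¬Any⇒All¬ _ (new ∘ ∈-++⁺ˡ) ∷ distinctOut adm
    ; xNotOutput  = (λ i g≡x → new (subst (_∈ availableCols P) (sym g≡x) (xCol∈availableCols P i)))
                    ∷ xNotOutput adm
    ; rNotInput   = r∉ ∘ inputs ∷ rNotInput adm
    }

  prune : ∀ {s} (r : Col n) (gs : Gates n s) → Σ (List (Gate n)) λ P →
    Admissible r P × length P ≤ s ×
    (r ∈ availableCols P ⊎ (∀ o → lookup (nodeCols gs) o ∈ availableCols P))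
  prune r [] = [] , Admissible-[] , z≤n ,
    inj₂ λ o → subst (_∈ availableCols []) (sym (lookup∘tabulate xCol o)) (xCol∈availableCols [] o)
  prune r (gs ▷ g) with prune r gs
  ... | P , adm , len , inj₁ r∈ = P , adm , m≤n⇒m≤1+n len , inj₁ r∈
  ... | P , adm , len , inj₂ nodes∈
    with r ∈? availableCols P | outCol (columnGate g (nodeCols gs)) ∈? availableCols P
  ... | yes r∈ | _      = P , adm , m≤n⇒m≤1+n len , inj₁ r∈
  ... | no r∉  | yes g∈ =
    P , adm , m≤n⇒m≤1+n len , inj₂ λ { zero → g∈ ; (suc o) → nodes∈ o }
  ... | no r∉  | no g∉  =
    columnGate g (nodeCols gs) ∷ P ,
    Admissible-∷ adm (columnGate-inputs g (nodeCols gs) nodes∈) r∉ g∉ , s≤s len ,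
    inj₂ λ { zero → here refl ; (suc o) → there (nodes∈ o) }

  module _ (w : PFun n) (k : Fin (2 ^ n)) where

    ReadsRow : Col n → Set
    ReadsRow c = w c ≡ just (lookup c k)

    misreads : ∀ {c b} → lookup c k ≡ b → ¬ ReadsRow c → w c ≢ just b
    misreads refl misread = misread

    covers-misread : (g : Gate n) → AllInputs ReadsRow g → ¬ ReadsRow (outCol g) → Covers g w
    covers-misread (andG u v) reads misread =
      lookup u k , lookup v k , reads (inj₁ refl) , reads (inj₂ refl) ,
      misreads (lookup-zipWith _∧_ k u v) misread
    covers-misread (orG u v) reads misread =
      lookup u k , lookup v k , reads (inj₁ refl) , reads (inj₂ refl) ,
      misreads (lookup-zipWith _∨_ k u v) misread
    covers-misread (notG u) reads misread =
      lookup u k , reads refl , misreads (lookup-map k not u) misread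

    covered⊎readsAvailable : (∀ i → ReadsRow (xCol i)) →
      (P : List (Gate n)) → WellFormed P →
      (Σ (Gate n) λ g → g ∈ P × Covers g w) ⊎ All ReadsRow (availableCols P)
    covered⊎readsAvailable readsX [] _ = inj₂ (All.tabulate⁺ {f = xCol {n}} readsX)
    covered⊎readsAvailable readsX (g ∷ P) (inputs , wf) with covered⊎readsAvailable readsX P wf
    ... | inj₁ (h , h∈P , covers) = inj₁ (h , there h∈P , covers)
    ... | inj₂ reads with Maybe.≡-dec _≟ᵇ_ (w (outCol g)) (just (lookup (outCol g) k))
    ...   | yes readsOut = inj₂ (readsOut ∷ reads)
    ...   | no misread   =
      inj₁ (g , here refl , covers-misread g (All.lookup reads ∘ inputs) misread)

  Admissible⇒IsPPolCover : ∀ {f : Vec Bool n → Bool} {P} → Admissible (rCol f) P →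
    rCol f ∈ availableCols P → IsPPolCover f P
  Admissible⇒IsPPolCover {f} {P} adm r∈ = record
    { covering    = covering
    ; distinctOut = distinctOut adm
    ; rNotInput   = λ _ → All.lookup (rNotInput adm)
    ; xNotOutput  = λ _ → All.lookup (xNotOutput adm)
    }
    where
      readsX : ∀ (w : PFun n) {bs k} → lookup (allInputs n) k ≡ bs →
        (∀ i → w (xCol i) ≡ just (lookup bs i)) → ∀ i → ReadsRow w k (xCol i)
      readsX w {k = k} k↦bs w-x i =
        trans (w-x i) (cong just (sym (trans (lookup-xCol i k) (cong (λ a → lookup a i) k↦bs))))

      covering : (w : PFun n) → InPPolBar f w → Σ (Gate n) λ g → g ∈ P × Covers g w
      covering w (bs , c , w-x , w-r , c≢fbs) with allInputs-complete bs
      ... | k , k↦bs with covered⊎readsAvailable w k (readsX w k↦bs w-x) P (wellFormed adm)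
      ... | inj₁ covered = covered
      ... | inj₂ reads = contradiction c≡fbs c≢fbs
        where
          c≡fbs : c ≡ f bs
          c≡fbs = Maybe.just-injective (trans (sym w-r) (trans (All.lookup reads r∈)
            (cong just (trans (lookup-rCol f k) (cong f k↦bs)))))

mainTheorem3 : (n : ℕ) → 1 ≤ n → (f : Vec Bool n → Bool) →
    (s : ℕ) (C : Gates n s) (o : Fin (s + n)) → Computes C o f →
    Σ (List (Gate n)) λ P → IsPPolCover f P × (length P ≤ s)
mainTheorem3 n _ f s C o computes with prune (rCol f) C
... | P , adm , len , reached = P , Admissible⇒IsPPolCover adm r∈ , len
  where
    r∈ : rCol f ∈ availableCols P
    r∈ = [ id , (λ nodes∈ → subst (_∈ availableCols P) (nodeCol≡rCol C o computes) (nodes∈ o)) ]′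
           reached
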